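{- Every polynomial computed by an algebraic branching program (ABP) of size $s$ can be represented as a DPP of size $\mathrm{poly}(s)$: there exist $N\le\mathrm{poly}(s)$, a constant matrix $L\in\mathbb{F}^{N\times N}$ and affine linear forms $\ell_1,\dots,\ell_N$ in the variables of the ABP (each being a constant or a single variable) such that the polynomial computed by the ABP equals $\det\big(L+\mathrm{diag}(\ell_1,\dots,\ell_N)\big)$.
   Context: An algebraic branching program (ABP) is a directed acyclic graph with a source $s$ and a sink $t$ whose edges are labeled with field constants or variables; the weight of an $s$–$t$ path is the product of its edge labels, and the ABP computes the sum of the weights of all $s$–$t$ paths. Its size is its number of nodes and edges. A determinantal point process (DPP), viewed as a polynomial, is $\det(L+\mathbf{X})$ with $L$ a constant $N\times N$ matrix and $\mathbf{X}$ a diagonal matrix of variables; its size is $N$. $\mathbb{F}$ is the underlying field; positive semidefiniteness of $L$ is not required. -}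

module Defs where

open import Level using (Level; _⊔_) renaming (suc to lsuc)
open import Data.Nat using (ℕ; zero; suc; _+_; _<_)
open import Data.Fin using (Fin; zero; suc; toℕ; punchIn; _≟_)
open import Data.List using (List; []; _∷_; [_]; map; concatMap; foldr; length; upTo; allFin)
open import Data.List.Relation.Unary.All using (All)
open import Data.Product using (Σ; _×_; _,_; proj₁; proj₂)
open import Data.Bool using (if_then_else_)
open import Relation.Nullary using (¬_)
open import Relation.Nullary.Decidable using (⌊_⌋)
open import Algebra.Bundles using (CommutativeRing)

record Field (c ℓ : Level) : Set (lsuc (c ⊔ ℓ)) where
  field
    commutativeRing : CommutativeRing c ℓ
  open CommutativeRing commutativeRing public
  field
    0≉1     : ¬ (0# ≈ 1#)
    inverse : ∀ x → ¬ (x ≈ 0#) → Σ Carrier (λ y → x * y ≈ 1#)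

module _ {c ℓ : Level} (F : Field c ℓ) where
  open Field F using () renaming (Carrier to 𝔽; _≈_ to _≈F_; _+_ to _+F_; _*_ to _*F_; 0# to 0#; 1# to 1#)

  -- The polynomial ring F[x₁,…,xₙ], constructed as the free commutative
  -- F-algebra on n generators: polynomial expressions modulo the
  -- congruence generated by the commutative-ring axioms and the
  -- requirement that constants add/multiply as in F.

  data Poly (n : ℕ) : Set c where
    con  : 𝔽 → Poly n
    var  : Fin n → Poly n
    _⊕_  : Poly n → Poly n → Poly n
    _⊗_  : Poly n → Poly n → Poly n
    ⊖_   : Poly n → Poly n

  infixl 6 _⊕_
  infixl 7 _⊗_
  infix 4 _≈ₚ_

  data _≈ₚ_ {n : ℕ} : Poly n → Poly n → Set (c ⊔ ℓ) where
    ≈-refl    : ∀ {p} → p ≈ₚ p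
    ≈-sym     : ∀ {p q} → p ≈ₚ q → q ≈ₚ p
    ≈-trans   : ∀ {p q r} → p ≈ₚ q → q ≈ₚ r → p ≈ₚ r
    con-cong  : ∀ {a b} → a ≈F b → con a ≈ₚ con b
    ⊕-cong    : ∀ {p p' q q'} → p ≈ₚ p' → q ≈ₚ q' → p ⊕ q ≈ₚ p' ⊕ q'
    ⊗-cong    : ∀ {p p' q q'} → p ≈ₚ p' → q ≈ₚ q' → p ⊗ q ≈ₚ p' ⊗ q'
    ⊖-cong    : ∀ {p q} → p ≈ₚ q → ⊖ p ≈ₚ ⊖ q
    ⊕-assoc   : ∀ p q r → (p ⊕ q) ⊕ r ≈ₚ p ⊕ (q ⊕ r)
    ⊕-comm    : ∀ p q → p ⊕ q ≈ₚ q ⊕ p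
    ⊕-idˡ     : ∀ p → con 0# ⊕ p ≈ₚ p
    ⊖-invˡ    : ∀ p → (⊖ p) ⊕ p ≈ₚ con 0#
    ⊗-assoc   : ∀ p q r → (p ⊗ q) ⊗ r ≈ₚ p ⊗ (q ⊗ r)
    ⊗-comm    : ∀ p q → p ⊗ q ≈ₚ q ⊗ p
    ⊗-idˡ     : ∀ p → con 1# ⊗ p ≈ₚ p
    distribˡ  : ∀ p q r → p ⊗ (q ⊕ r) ≈ₚ (p ⊗ q) ⊕ (p ⊗ r)
    con-+     : ∀ a b → con (a +F b) ≈ₚ con a ⊕ con b
    con-*     : ∀ a b → con (a *F b) ≈ₚ con a ⊗ con b

  -- Labels: a field constant or a single variable (used both for ABP
  -- edge labels and for the affine forms ℓᵢ of the DPP).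

  data Label (n : ℕ) : Set c where
    cst : 𝔽 → Label n
    var : Fin n → Label n

  ⟦_⟧ : ∀ {n} → Label n → Poly n
  ⟦ cst a ⟧ = con a
  ⟦ var i ⟧ = var i

  sumₚ : ∀ {n} → List (Poly n) → Poly n
  sumₚ = foldr _⊕_ (con 0#)

  prodₚ : ∀ {n} → List (Poly n) → Poly n
  prodₚ = foldr _⊗_ (con 1#)

  -- Acyclicity is expressed by a topological order: every edge goes from
  -- a smaller to a larger node (every DAG admits such a numbering).

  Edge : ℕ → ℕ → Set c
  Edge n m = Fin m × Fin m × Label n

  from : ∀ {n m} → Edge n m → Fin m
  from e = proj₁ e

  to : ∀ {n m} → Edge n m → Fin m
  to e = proj₁ (proj₂ e)

  label : ∀ {n m} → Edge n m → Label n
  label e = proj₂ (proj₂ e)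

  record ABP (n : ℕ) : Set c where
    field
      m       : ℕ
      source  : Fin m
      sink    : Fin m
      edges   : List (Edge n m)
      acyclic : All (λ e → toℕ (from e) < toℕ (to e)) edges

    pathsOfLength : Fin m → ℕ → List (List (Edge n m))
    pathsOfLength u zero    = if ⌊ u ≟ sink ⌋ then [ [] ] else []
    pathsOfLength u (suc k) =
      concatMap (λ e → if ⌊ from e ≟ u ⌋
                          then map (e ∷_) (pathsOfLength (to e) k)
                          else [])
                edges

    -- all source–sink paths (by acyclicity every path has < m edges)
    paths : List (List (Edge n m))
    paths = concatMap (pathsOfLength source) (upTo m)

    weight : List (Edge n m) → Poly n
    weight p = prodₚ (map (λ e → ⟦ label e ⟧) p)

    computes : Poly n
    computes = sumₚ (map weight paths)

    size : ℕ
    size = m + length edges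

  sign : ∀ {n} → ℕ → Poly n
  sign zero    = con 1#
  sign (suc k) = ⊖ sign k

  det : ∀ {n} (N : ℕ) → (Fin N → Fin N → Poly n) → Poly n
  det zero    M = con 1#
  det (suc N) M =
    sumₚ (map (λ j → sign (toℕ j) ⊗ M zero j ⊗ det N (λ i k → M (suc i) (punchIn j k)))
              (allFin (suc N)))

  dppMatrix : ∀ {n N} → (Fin N → Fin N → 𝔽) → (Fin N → Label n)
            → Fin N → Fin N → Poly n
  dppMatrix L ℓs i j = if ⌊ i ≟ j ⌋ then con (L i j) ⊕ ⟦ ℓs i ⟧ else con (L i j)

-- Let H be a lower Hessenberg matrix with -1 on the superdiagonal,
-- constants below it, and constant-plus-label entries on the diagonal.
-- Expanding along the first row shows that its trailing principal minors
-- D₀ = 1, D₁, …, D_N = det H satisfy D_{j+1} = ℓ·Dⱼ + Σ_{i≤j} cᵢ·Dᵢ,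
-- where ℓ is the label and the cᵢ the constants of one column. Read as a
-- straight-line program, each step multiplies the previous value by a
-- label and adds a constant combination of earlier values. That is enough
-- to evaluate the ABP layer by layer: the sum p(u, k) over length-k paths
-- from u to the sink satisfies p(u, k+1) = Σ_{e : u → v} label(e)·p(v, k),
-- and the ABP computes Σ_{k<m} p(source, k). This takes O(m²·|E|) steps.
module Submission where

open import Level using (Level; _⊔_)
open import Defs
open import Data.Nat as ℕ using (ℕ; zero; suc; _+_; _*_; _∸_; _^_; _≤_; _<_; s≤s; z≤n)
import Data.Nat.Properties as ℕ
open import Data.Nat.Tactic.RingSolver using (solve-∀)
open import Data.Fin using (Fin; zero; suc; toℕ; punchIn; _≟_)
open import Data.List using (List; []; _∷_; [_]; map; length; upTo; concatMap; _++_; lookup; allFin)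
open import Data.List.Properties using (length-upTo)
open import Data.List.Relation.Unary.All as All using (All; []; _∷_)
open import Data.List.Relation.Unary.All.Properties using (all-upTo; tabulate⁺)
open import Data.List.Relation.Binary.Suffix.Heterogeneous using (Suffix; here; there)
import Data.List.Relation.Binary.Suffix.Heterogeneous.Properties as Suffix
import Data.List.Relation.Binary.Pointwise as Pointwise
open import Data.Product using (Σ; ∃-syntax; _×_; _,_)
open import Data.Sum using (inj₁; inj₂)
open import Data.Unit using (⊤; tt)
open import Data.Bool using (Bool; true; false; if_then_else_)
open import Function using (_∘_)
open import Relation.Nullary using (does)
open import Relation.Nullary.Decidable using (⌊_⌋; dec-true; dec-false; isYes≗does)
open import Relation.Binary.PropositionalEquality as ≡ using (_≡_; refl)
open import Algebra.Bundles using (CommutativeRing)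

cubic-bound : ∀ s → suc (s * 2) + (s * (s * suc (s * 2)) + s * 3) ≤ 8 * s ^ 3 + 8
cubic-bound zero    = s≤s z≤n
cubic-bound (suc u) = ℕ.≤-trans (ℕ.m≤m+n _ _) (ℕ.≤-reflexive (≡.sym (expand u)))
  where
  expand : ∀ x → 8 * ((1 + x) * ((1 + x) * ((1 + x) * 1))) + 8
               ≡ (1 + (1 + x) * 2 + ((1 + x) * ((1 + x) * (1 + (1 + x) * 2)) + (1 + x) * 3))
                 + (6 * x * x * x + 17 * x * x + 11 * x + 7)
  expand = solve-∀

rowCount-bound : ∀ m e → suc (m * 2) + (m * (m * suc (e * 2)) + m * 3) ≤ 8 * (m + e) ^ 3 + 8
rowCount-bound m e = ℕ.≤-trans monotone (cubic-bound (m + e))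
  where
  m≤s = ℕ.m≤m+n m e
  e≤s = ℕ.m≤n+m e m
  monotone = ℕ.+-mono-≤ (s≤s (ℕ.*-monoˡ-≤ 2 m≤s))
               (ℕ.+-mono-≤ (ℕ.*-mono-≤ m≤s (ℕ.*-mono-≤ m≤s (s≤s (ℕ.*-monoˡ-≤ 2 e≤s))))
                           (ℕ.*-monoˡ-≤ 3 m≤s))

module Construction {c ℓ : Level} (F : Field c ℓ) (n : ℕ) where
  open Field F using (0#; 1#; -_) renaming (Carrier to 𝔽)

  Pol : Set c
  Pol = Poly F n

  infix 4 _≈_
  _≈_ : Pol → Pol → Set (c ⊔ ℓ)
  _≈_ = _≈ₚ_ F

  0p 1p : Pol
  0p = con 0#
  1p = con 1#

  polyRing : CommutativeRing c (c ⊔ ℓ)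
  polyRing = record
    { Carrier = Pol ; _≈_ = _≈_ ; _+_ = _⊕_ ; _*_ = _⊗_ ; -_ = ⊖_ ; 0# = 0p ; 1# = 1p
    ; isCommutativeRing = record
      { isRing = record
        { +-isAbelianGroup = record
          { isGroup = record
            { isMonoid = record
              { isSemigroup = record
                { isMagma = record
                  { isEquivalence = record { refl = ≈-refl ; sym = ≈-sym ; trans = ≈-trans }
                  ; ∙-cong = ⊕-cong }
                ; assoc = ⊕-assoc }
              ; identity = ⊕-idˡ , λ p → ≈-trans (⊕-comm p 0p) (⊕-idˡ p) }
            ; inverse = ⊖-invˡ , λ p → ≈-trans (⊕-comm p (⊖ p)) (⊖-invˡ p)
            ; ⁻¹-cong = ⊖-cong }
          ; comm = ⊕-comm }
        ; *-cong = ⊗-cong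
        ; *-assoc = ⊗-assoc
        ; *-identity = ⊗-idˡ , λ p → ≈-trans (⊗-comm p 1p) (⊗-idˡ p)
        ; distrib = distribˡ , λ p q r → ≈-trans (⊗-comm (q ⊕ r) p)
                                           (≈-trans (distribˡ p q r) (⊕-cong (⊗-comm p q) (⊗-comm p r))) }
      ; *-comm = ⊗-comm } }

  open CommutativeRing polyRing
    using (setoid; reflexive; +-identityʳ; *-identityʳ; distribʳ; zeroˡ; zeroʳ; ring)
  open import Algebra.Properties.Ring ring using (-1*x≈-x; -‿involutive; +-inverseʳ-unique)
  open import Relation.Binary.Reasoning.Setoid setoid

  con-neg-one : con (- 1#) ≈ ⊖ 1p
  con-neg-one = +-inverseʳ-unique 1p (con (- 1#))
    (≈-trans (⊕-comm _ _) (≈-trans (≈-sym (con-+ (- 1#) 1#)) (con-cong (Field.-‿inverseˡ F 1#))))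

  sum-cong : ∀ {a} {A : Set a} {f g : A → Pol} xs → (∀ x → f x ≈ g x)
           → sumₚ F (map f xs) ≈ sumₚ F (map g xs)
  sum-cong []       f≈g = ≈-refl
  sum-cong (x ∷ xs) f≈g = ⊕-cong (f≈g x) (sum-cong xs f≈g)

  sum-zero : ∀ {a} {A : Set a} {f : A → Pol} {xs} → All (λ x → f x ≈ 0p) xs → sumₚ F (map f xs) ≈ 0p
  sum-zero []            = ≈-refl
  sum-zero (fx≈0 ∷ rest) = ≈-trans (⊕-cong fx≈0 (sum-zero rest)) (⊕-idˡ 0p)

  sum-++ : ∀ {a} {A : Set a} (f : A → Pol) xs ys
         → sumₚ F (map f (xs ++ ys)) ≈ sumₚ F (map f xs) ⊕ sumₚ F (map f ys)
  sum-++ f []       ys = ≈-sym (⊕-idˡ _)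
  sum-++ f (x ∷ xs) ys = ≈-trans (⊕-cong ≈-refl (sum-++ f xs ys)) (≈-sym (⊕-assoc _ _ _))

  sum-concatMap : ∀ {a b} {A : Set a} {B : Set b} (f : B → Pol) (g : A → List B) xs
                → sumₚ F (map f (concatMap g xs)) ≈ sumₚ F (map (λ x → sumₚ F (map f (g x))) xs)
  sum-concatMap f g []       = ≈-refl
  sum-concatMap f g (x ∷ xs) = ≈-trans (sum-++ f (g x) (concatMap g xs)) (⊕-cong ≈-refl (sum-concatMap f g xs))

  det-cong : ∀ N {M M′ : Fin N → Fin N → Pol} → (∀ i j → M i j ≈ M′ i j) → det F N M ≈ det F N M′
  det-cong zero    M≈M′ = ≈-refl
  det-cong (suc N) M≈M′ = sum-cong (allFin (suc N)) λ j →
    ⊗-cong (⊗-cong ≈-refl (M≈M′ zero j)) (det-cong N λ i k → M≈M′ (suc i) (punchIn j k))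

  minor : ∀ {N} → Fin (suc N) → (Fin (suc N) → Fin (suc N) → Pol) → Fin N → Fin N → Pol
  minor j M i k = M (suc i) (punchIn j k)

  det-firstRow-x,-1,0 : ∀ N (M : Fin (2 + N) → Fin (2 + N) → Pol)
    → M zero (suc zero) ≈ con (- 1#) → (∀ j → M zero (suc (suc j)) ≈ 0p)
    → det F (2 + N) M ≈ M zero zero ⊗ det F (1 + N) (minor zero M) ⊕ det F (1 + N) (minor (suc zero) M)
  det-firstRow-x,-1,0 N M M₀₁≈-1 M₀ⱼ≈0 =
    ⊕-cong (⊗-cong (⊗-idˡ _) ≈-refl) (≈-trans (⊕-cong minusOne² rest≈0) (+-identityʳ _))
    where
    minusOne² : ⊖ 1p ⊗ M zero (suc zero) ⊗ det F (1 + N) (minor (suc zero) M) ≈ det F (1 + N) (minor (suc zero) M)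
    minusOne² = ≈-trans (⊗-cong (≈-trans (⊗-cong ≈-refl (≈-trans M₀₁≈-1 con-neg-one))
                                          (≈-trans (-1*x≈-x (⊖ 1p)) (-‿involutive 1p))) ≈-refl)
                         (⊗-idˡ _)
    rest≈0 = sum-zero (tabulate⁺ λ j → ≈-trans (⊗-cong (≈-trans (⊗-cong ≈-refl (M₀ⱼ≈0 j)) (zeroʳ _)) ≈-refl) (zeroˡ _))

  -- One column of the Hessenberg matrix: its constants on and below the
  -- diagonal, indexed by the length of the program suffix whose value they
  -- multiply, and the label added on the diagonal.
  record Instr : Set c where
    field
      coeff : ℕ → 𝔽
      diag  : Label F n
  open Instr

  -- The head of the list is the last instruction (the first matrix column).
  Program : Set c
  Program = List Instr

  mutual
    value : Program → Pol
    value []       = 1p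
    value (r ∷ rs) = (con (coeff r (length rs)) ⊕ ⟦ F ⟧ (diag r)) ⊗ value rs ⊕ lowerSum (con ∘ coeff r) rs

    lowerSum : (ℕ → Pol) → Program → Pol
    lowerSum w []       = 0p
    lowerSum w (r ∷ rs) = w (length rs) ⊗ value rs ⊕ lowerSum w rs

  minusE₀ : ∀ {N} → Fin N → 𝔽
  minusE₀ zero    = - 1#
  minusE₀ (suc _) = 0#

  hessenberg : (rs : Program) → Fin (length rs) → Fin (length rs) → 𝔽
  hessenberg (r ∷ rs) zero    zero    = coeff r (length rs)
  hessenberg (r ∷ rs) (suc i) zero    = coeff r (length rs ∸ suc (toℕ i))
  hessenberg (r ∷ rs) zero    (suc k) = minusE₀ k
  hessenberg (r ∷ rs) (suc i) (suc k) = hessenberg rs i k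

  diagonal : (rs : Program) → Fin (length rs) → Label F n
  diagonal rs i = diag (lookup rs i)

  matrix : (rs : Program) → Fin (length rs) → Fin (length rs) → Pol
  matrix rs = dppMatrix F (hessenberg rs) (diagonal rs)

  matrix-suc : ∀ r rs i j → matrix (r ∷ rs) (suc i) (suc j) ≈ matrix rs i j
  matrix-suc r rs i j = reflexive (≡.cong (λ b → if b then con (hessenberg rs i j) ⊕ ⟦ F ⟧ (diagonal rs i)
                                                  else con (hessenberg rs i j))
                                    (≡.trans (isYes≗does (suc i ≟ suc j)) (≡.sym (isYes≗does (i ≟ j)))))

  bordered : Pol → (ℕ → Pol) → (rs : Program) → Fin (suc (length rs)) → Fin (suc (length rs)) → Pol
  bordered x w rs zero    zero    = x
  bordered x w rs (suc i) zero    = w (length rs ∸ suc (toℕ i))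
  bordered x w rs zero    (suc k) = con (minusE₀ k)
  bordered x w rs (suc i) (suc k) = matrix rs i k

  matrix≈bordered : ∀ r rs i j
    → matrix (r ∷ rs) i j ≈ bordered (con (coeff r (length rs)) ⊕ ⟦ F ⟧ (diag r)) (con ∘ coeff r) rs i j
  matrix≈bordered r rs zero    zero    = ≈-refl
  matrix≈bordered r rs zero    (suc j) = ≈-refl
  matrix≈bordered r rs (suc i) zero    = ≈-refl
  matrix≈bordered r rs (suc i) (suc j) = matrix-suc r rs i j

  minor₁-bordered : ∀ x w r rs i k
    → minor (suc zero) (bordered x w (r ∷ rs)) i k ≈ bordered (w (length rs)) w rs i k
  minor₁-bordered x w r rs zero    zero    = ≈-refl
  minor₁-bordered x w r rs (suc i) zero    = ≈-refl
  minor₁-bordered x w r rs zero    (suc k) = ≈-refl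
  minor₁-bordered x w r rs (suc i) (suc k) = matrix-suc r rs i k

  mutual
    det-matrix : ∀ rs → det F (length rs) (matrix rs) ≈ value rs
    det-matrix []       = ≈-refl
    det-matrix (r ∷ rs) = ≈-trans (det-cong (suc (length rs)) (matrix≈bordered r rs)) (det-bordered _ _ rs)

    det-bordered : ∀ x w rs → det F (suc (length rs)) (bordered x w rs) ≈ x ⊗ value rs ⊕ lowerSum w rs
    det-bordered x w []       = ⊕-cong (⊗-cong (⊗-idˡ x) ≈-refl) ≈-refl
    det-bordered x w (r ∷ rs) = begin
      det F (2 + length rs) (bordered x w (r ∷ rs))
        ≈⟨ det-firstRow-x,-1,0 (length rs) (bordered x w (r ∷ rs)) ≈-refl (λ _ → ≈-refl) ⟩
      x ⊗ det F (1 + length rs) (matrix (r ∷ rs)) ⊕ det F (1 + length rs) (minor (suc zero) (bordered x w (r ∷ rs)))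
        ≈⟨ ⊕-cong (⊗-cong ≈-refl (det-matrix (r ∷ rs)))
                  (≈-trans (det-cong (suc (length rs)) (minor₁-bordered x w r rs)) (det-bordered (w (length rs)) w rs)) ⟩
      x ⊗ value (r ∷ rs) ⊕ (w (length rs) ⊗ value rs ⊕ lowerSum w rs)  ∎

  -- Slot d holds the value of the suffix of length d; slot 0 holds 1.
  valueAt : Program → ℕ → Pol
  valueAt []       d = 1p
  valueAt (r ∷ rs) d = if does (d ℕ.≟ suc (length rs)) then value (r ∷ rs) else valueAt rs d

  valueAt-length : ∀ rs → valueAt rs (length rs) ≡ value rs
  valueAt-length []       = refl
  valueAt-length (r ∷ rs) rewrite dec-true (suc (length rs) ℕ.≟ suc (length rs)) refl = refl

  valueAt-cons : ∀ r rs {d} → d ≤ length rs → valueAt (r ∷ rs) d ≡ valueAt rs d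
  valueAt-cons r rs {d} d≤ rewrite dec-false (d ℕ.≟ suc (length rs)) (ℕ.<⇒≢ (s≤s d≤)) = refl

  Stores : Program → ℕ → Pol → Set (c ⊔ ℓ)
  Stores rs d p = d ≤ length rs × valueAt rs d ≈ p

  infix 4 _≼_
  _≼_ : Program → Program → Set c
  _≼_ = Suffix _≡_

  ≼-refl : ∀ {rs} → rs ≼ rs
  ≼-refl = here (Pointwise.refl refl)

  ≼-trans : ∀ {rs ss ts} → rs ≼ ss → ss ≼ ts → rs ≼ ts
  ≼-trans = Suffix.trans ≡.trans

  stores-top : ∀ rs {p} → value rs ≈ p → Stores rs (length rs) p
  stores-top rs v≈p = ℕ.≤-refl , ≈-trans (reflexive (valueAt-length rs)) v≈p

  stores-≼ : ∀ {rs ss d p} → rs ≼ ss → Stores rs d p → Stores ss d p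
  stores-≼ (here rs≡ss) stored rewrite Pointwise.Pointwise-≡⇒≡ rs≡ss = stored
  stores-≼ (there {b = r} {bs = ss} rs≼ss) stored with stores-≼ rs≼ss stored
  ... | d≤ , v≈p = ℕ.m≤n⇒m≤1+n d≤ , ≈-trans (reflexive (valueAt-cons r ss d≤)) v≈p

  zeroInstr : Instr
  zeroInstr = record { coeff = λ _ → 0# ; diag = cst 0# }

  step : Label F n → ℕ → Instr
  step ℓ t = record { coeff = λ d → if does (d ℕ.≟ t) then 1# else 0# ; diag = ℓ }

  value-zeroInstr : ∀ rs → value (zeroInstr ∷ rs) ≈ 0p
  value-zeroInstr rs = ≈-trans (⊕-cong (≈-trans (⊗-cong (⊕-idˡ 0p) ≈-refl) (zeroˡ _)) (lowerSum-zero rs)) (⊕-idˡ 0p)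
    where
    lowerSum-zero : ∀ rs → lowerSum (λ _ → 0p) rs ≈ 0p
    lowerSum-zero []       = ≈-refl
    lowerSum-zero (r ∷ rs) = ≈-trans (⊕-cong (zeroˡ _) (lowerSum-zero rs)) (⊕-idˡ 0p)

  lowerSum-step-above : ∀ ℓ {t} rs → length rs ≤ t → lowerSum (con ∘ coeff (step ℓ t)) rs ≈ 0p
  lowerSum-step-above ℓ     []       _   = ≈-refl
  lowerSum-step-above ℓ {t} (r ∷ rs) n<t rewrite dec-false (length rs ℕ.≟ t) (ℕ.<⇒≢ n<t) =
    ≈-trans (⊕-cong (zeroˡ _) (lowerSum-step-above ℓ rs (ℕ.<⇒≤ n<t))) (⊕-idˡ 0p)

  lowerSum-step : ∀ ℓ {t} rs → t < length rs → lowerSum (con ∘ coeff (step ℓ t)) rs ≈ valueAt rs t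
  lowerSum-step ℓ {t} (r ∷ rs) t<1+n with ℕ.m≤n⇒m<n∨m≡n (ℕ.≤-pred t<1+n)
  ... | inj₁ t<n rewrite dec-false (length rs ℕ.≟ t) (ℕ.>⇒≢ t<n) | valueAt-cons r rs (ℕ.<⇒≤ t<n) =
    ≈-trans (⊕-cong (zeroˡ _) (lowerSum-step ℓ rs t<n)) (⊕-idˡ _)
  ... | inj₂ refl rewrite dec-true (length rs ℕ.≟ length rs) refl | valueAt-cons r rs ℕ.≤-refl | valueAt-length rs =
    ≈-trans (⊕-cong (⊗-idˡ _) (lowerSum-step-above ℓ rs ℕ.≤-refl)) (+-identityʳ _)

  value-step : ∀ ℓ {t p} rs → Stores rs t p → value (step ℓ t ∷ rs) ≈ ⟦ F ⟧ ℓ ⊗ value rs ⊕ p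
  value-step ℓ {t} rs (t≤n , stored) with ℕ.m≤n⇒m<n∨m≡n t≤n
  ... | inj₁ t<n rewrite dec-false (length rs ℕ.≟ t) (ℕ.>⇒≢ t<n) =
    ⊕-cong (⊗-cong (⊕-idˡ _) ≈-refl) (≈-trans (lowerSum-step ℓ rs t<n) stored)
  ... | inj₂ refl rewrite dec-true (length rs ℕ.≟ length rs) refl = begin
    (1p ⊕ ⟦ F ⟧ ℓ) ⊗ value rs ⊕ lowerSum _ rs     ≈⟨ ⊕-cong (distribʳ _ _ _) (lowerSum-step-above ℓ rs ℕ.≤-refl) ⟩
    (1p ⊗ value rs ⊕ ⟦ F ⟧ ℓ ⊗ value rs) ⊕ 0p     ≈⟨ +-identityʳ _ ⟩
    1p ⊗ value rs ⊕ ⟦ F ⟧ ℓ ⊗ value rs            ≈⟨ ⊕-comm _ _ ⟩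
    ⟦ F ⟧ ℓ ⊗ value rs ⊕ 1p ⊗ value rs            ≈⟨ ⊕-cong ≈-refl (⊗-idˡ _) ⟩
    ⟦ F ⟧ ℓ ⊗ value rs ⊕ value rs                 ≈⟨ ⊕-cong ≈-refl (≈-trans (reflexive (≡.sym (valueAt-length rs))) stored) ⟩
    ⟦ F ⟧ ℓ ⊗ value rs ⊕ _                         ∎

  module _ {a} {I : Set a} (slot : I → ℕ) where

    -- Each term is copied to the top and then multiplied by its label
    -- while being added to the running sum.
    linComb : (I → Label F n) → List I → Program → Program
    linComb lab []       rs = zeroInstr ∷ rs
    linComb lab (i ∷ is) rs = step (lab i) (length acc) ∷ step (cst 0#) (slot i) ∷ acc
      where acc = linComb lab is rs

    linComb-length : ∀ lab is rs → length (linComb lab is rs) ≡ suc (length is * 2) + length rs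
    linComb-length lab []       rs = refl
    linComb-length lab (i ∷ is) rs = ≡.cong (λ l → suc (suc l)) (linComb-length lab is rs)

    linComb-≼ : ∀ lab is rs → rs ≼ linComb lab is rs
    linComb-≼ lab []       rs = there ≼-refl
    linComb-≼ lab (i ∷ is) rs = there (there (linComb-≼ lab is rs))

    linComb-value : ∀ lab (q : I → Pol) is rs → All (λ i → Stores rs (slot i) (q i)) is
                  → value (linComb lab is rs) ≈ sumₚ F (map (λ i → ⟦ F ⟧ (lab i) ⊗ q i) is)
    linComb-value lab q []       rs []              = value-zeroInstr rs
    linComb-value lab q (i ∷ is) rs (stored ∷ rest) = begin
      value (step (lab i) (length acc) ∷ copy ∷ acc)  ≈⟨ value-step (lab i) (copy ∷ acc) (stores-≼ (there ≼-refl) (stores-top acc ≈-refl)) ⟩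
      ⟦ F ⟧ (lab i) ⊗ value (copy ∷ acc) ⊕ value acc  ≈⟨ ⊕-cong (⊗-cong ≈-refl copy≈q) (linComb-value lab q is rs rest) ⟩
      ⟦ F ⟧ (lab i) ⊗ q i ⊕ _                          ∎
      where
      acc = linComb lab is rs
      copy = step (cst 0#) (slot i)
      copy≈q : value (copy ∷ acc) ≈ q i
      copy≈q = ≈-trans (value-step (cst 0#) acc (stores-≼ (linComb-≼ lab is rs) stored))
                       (≈-trans (⊕-cong (zeroˡ _) ≈-refl) (⊕-idˡ _))

    layer : ∀ {m} → List I → (Fin m → I → Label F n) → Program → Program
    layer {zero}  is lab rs = rs
    layer {suc m} is lab rs = layer is (lab ∘ suc) (linComb (lab zero) is rs)

    layer-length : ∀ {m} is (lab : Fin m → I → Label F n) rs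
                 → length (layer is lab rs) ≡ m * suc (length is * 2) + length rs
    layer-length {zero}  is lab rs = refl
    layer-length {suc m} is lab rs =
      ≡.trans (layer-length is (lab ∘ suc) (linComb (lab zero) is rs))
              (≡.trans (≡.cong (m * suc (length is * 2) +_) (linComb-length (lab zero) is rs))
                       (rearrange (m * suc (length is * 2)) _ (length rs)))
      where
      rearrange : ∀ x b r → x + (b + r) ≡ b + x + r
      rearrange = solve-∀

    layer-≼ : ∀ {m} is (lab : Fin m → I → Label F n) rs → rs ≼ layer is lab rs
    layer-≼ {zero}  is lab rs = ≼-refl
    layer-≼ {suc m} is lab rs = ≼-trans (linComb-≼ (lab zero) is rs) (layer-≼ is (lab ∘ suc) _)

    layer-stores : ∀ {m} is (lab : Fin m → I → Label F n) (q : I → Pol) rs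
      → All (λ i → Stores rs (slot i) (q i)) is
      → ∀ v → Stores (layer is lab rs) (length rs + suc (toℕ v) * suc (length is * 2))
                     (sumₚ F (map (λ i → ⟦ F ⟧ (lab v i) ⊗ q i) is))
    layer-stores {suc m} is lab q rs stored zero =
      stores-≼ (layer-≼ is (lab ∘ suc) rs′)
        (≡.subst (λ d → Stores rs′ d _) (≡.trans (linComb-length (lab zero) is rs) (firstBlock _ (length rs)))
                 (stores-top rs′ (linComb-value (lab zero) q is rs stored)))
      where
      rs′ = linComb (lab zero) is rs
      firstBlock : ∀ b r → b + r ≡ r + 1 * b
      firstBlock = solve-∀
    layer-stores {suc m} is lab q rs stored (suc v) =
      ≡.subst (λ d → Stores (layer is (lab ∘ suc) rs′) d (sumₚ F (map (λ i → ⟦ F ⟧ (lab (suc v) i) ⊗ q i) is)))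
              (≡.trans (≡.cong (_+ suc (toℕ v) * suc (length is * 2)) (linComb-length (lab zero) is rs))
                       (nextBlock (suc (length is * 2)) (length rs) (toℕ v)))
              (layer-stores is (lab ∘ suc) q _ (All.map (stores-≼ (linComb-≼ (lab zero) is rs)) stored) v)
      where
      rs′ = linComb (lab zero) is rs
      nextBlock : ∀ b r v → b + r + suc v * b ≡ r + suc (suc v) * b
      nextBlock = solve-∀

  _when_ : Label F n → Bool → Label F n
  ℓ when b = if b then ℓ else cst 0#

  module Compile (A : ABP F n) where
    open ABP A

    pathSum : Fin m → ℕ → Pol
    pathSum u k = sumₚ F (map weight (pathsOfLength u k))

    pathSum-zero : ∀ u → pathSum u 0 ≈ ⟦ F ⟧ (cst 1# when ⌊ u ≟ sink ⌋)
    pathSum-zero u with ⌊ u ≟ sink ⌋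
    ... | true  = +-identityʳ 1p
    ... | false = ≈-refl

    pathSum-suc : ∀ u k → pathSum u (suc k)
                ≈ sumₚ F (map (λ e → ⟦ F ⟧ (label F e when ⌊ from F e ≟ u ⌋) ⊗ pathSum (to F e) k) edges)
    pathSum-suc u k = ≈-trans (sum-concatMap weight _ edges) (sum-cong edges λ e → firstEdge e ⌊ from F e ≟ u ⌋)
      where
      prepend : ∀ e ps → sumₚ F (map weight (map (e ∷_) ps)) ≈ ⟦ F ⟧ (label F e) ⊗ sumₚ F (map weight ps)
      prepend e []       = ≈-sym (zeroʳ _)
      prepend e (p ∷ ps) = ≈-trans (⊕-cong ≈-refl (prepend e ps)) (≈-sym (distribˡ _ _ _))

      firstEdge : ∀ e b → sumₚ F (map weight (if b then map (e ∷_) (pathsOfLength (to F e) k) else []))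
                        ≈ ⟦ F ⟧ (label F e when b) ⊗ pathSum (to F e) k
      firstEdge e true  = prepend e (pathsOfLength (to F e) k)
      firstEdge e false = ≈-sym (zeroˡ _)

    computes≈pathSums : computes ≈ sumₚ F (map (pathSum source) (upTo m))
    computes≈pathSums = sum-concatMap weight (pathsOfLength source) (upTo m)

    blockSize : ℕ
    blockSize = suc (length edges * 2)

    sinkIndicator : Fin m → ⊤ → Label F n
    sinkIndicator v _ = cst 1# when ⌊ v ≟ sink ⌋

    outEdge : Fin m → Edge F n m → Label F n
    outEdge v e = label F e when ⌊ from F e ≟ v ⌋

    mutual
      program : ℕ → Program
      program zero    = layer (λ _ → 0) [ tt ] sinkIndicator []
      program (suc k) = layer (targetSlot k) edges outEdge (program k)

      targetSlot : ℕ → Edge F n m → ℕ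
      targetSlot k e = slotOf (to F e) k

      slotOf : Fin m → ℕ → ℕ
      slotOf v zero    = suc (toℕ v) * 3
      slotOf v (suc k) = length (program k) + suc (toℕ v) * blockSize

    program-stores : ∀ k v → Stores (program k) (slotOf v k) (pathSum v k)
    program-stores zero v with layer-stores (λ _ → 0) [ tt ] sinkIndicator (λ _ → 1p) []
                                            ((z≤n , ≈-refl) ∷ []) v
    ... | d≤ , stored = d≤ , ≈-trans stored (≈-trans (+-identityʳ _) (≈-trans (*-identityʳ _) (≈-sym (pathSum-zero v))))
    program-stores (suc k) v with layer-stores (targetSlot k) edges outEdge
                                               (λ e → pathSum (to F e) k) (program k)
                                               (All.universal (λ e → program-stores k (to F e)) edges) v
    ... | d≤ , stored = d≤ , ≈-trans stored (≈-sym (pathSum-suc v k))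

    program-≼ : ∀ {j k} → j ≤ k → program j ≼ program k
    program-≼ {k = zero}  z≤n = ≼-refl
    program-≼ {k = suc k} j≤1+k with ℕ.m≤n⇒m<n∨m≡n j≤1+k
    ... | inj₁ j<1+k = ≼-trans (program-≼ (ℕ.≤-pred j<1+k)) (layer-≼ (targetSlot k) edges outEdge (program k))
    ... | inj₂ refl  = ≼-refl

    program-length : ∀ k → length (program k) ≡ k * (m * blockSize) + m * 3
    program-length zero    = ≡.trans (layer-length (λ _ → 0) [ tt ] sinkIndicator []) (ℕ.+-identityʳ (m * 3))
    program-length (suc k) =
      ≡.trans (layer-length (targetSlot k) edges outEdge (program k))
              (≡.trans (≡.cong (m * blockSize +_) (program-length k)) (≡.sym (ℕ.+-assoc (m * blockSize) _ _)))

    dppProgram : Program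
    dppProgram = linComb (slotOf source) (λ _ → cst 1#) (upTo m) (program m)

    dppProgram-value : value dppProgram ≈ computes
    dppProgram-value =
      ≈-trans (linComb-value (slotOf source) (λ _ → cst 1#) (pathSum source) (upTo m) (program m)
                 (All.map (λ {k} k<m → stores-≼ (program-≼ (ℕ.<⇒≤ k<m)) (program-stores k source)) (all-upTo m)))
              (≈-trans (sum-cong (upTo m) (λ k → ⊗-idˡ _)) (≈-sym computes≈pathSums))

    dppProgram-length : length dppProgram ≡ suc (m * 2) + (m * (m * blockSize) + m * 3)
    dppProgram-length =
      ≡.trans (linComb-length (slotOf source) _ (upTo m) (program m))
              (≡.cong₂ (λ k l → suc (k * 2) + l) (length-upTo m) (program-length m))

theorem7 : ∀ {a ℓ} → ∃[ c ] ∃[ k ] ((F : Field a ℓ) (n : ℕ) (A : ABP F n)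
               → ∃[ N ] ((N ≤ c * ABP.size A ^ k + c)
                 × Σ (Fin N → Fin N → Field.Carrier F) (λ L
                 → Σ (Fin N → Label F n) (λ ℓs
                 → _≈ₚ_ F (ABP.computes A) (det F N (dppMatrix F L ℓs))))))
theorem7 = 8 , 3 , λ F n A → let open Construction F n; open Compile A in
  length dppProgram ,
  ≡.subst (_≤ 8 * ABP.size A ^ 3 + 8) (≡.sym dppProgram-length) (rowCount-bound (ABP.m A) (length (ABP.edges A))) ,
  hessenberg dppProgram , diagonal dppProgram ,
  ≈-trans (≈-sym dppProgram-value) (≈-sym (det-matrix dppProgram))
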